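{- There exists an algorithm that computes, for a given $\sharp\mathsf{EP}$-formula $\phi$ of the form $C(\psi,L)$ (with $\psi$ an ep-formula), a logically equivalent $\sharp\mathsf{PP}$-formula $\phi'$ such that $\mathsf{width}(\phi')\le\mathsf{width}(\phi)$.
   Context: Structures are finite relational structures (no equality). pp-formulas are built from atoms with $\wedge,\exists$; ep-formulas additionally with $\vee$. $\sharp$-formulas: inductively, with free and closed variable sets: $C(\phi,L)$ ($\phi$ first-order, $L\supseteq\mathrm{free}(\phi)$; free $L$, closed $\emptyset$); $PV\psi$ ($V\cap\mathrm{closed}(\psi)=\emptyset$; free $\mathrm{free}(\psi)\setminus V$, closed $V\cup\mathrm{closed}(\psi)$); $EV\psi$ ($V$ disjoint from free and closed variables of $\psi$; free $V\cup\mathrm{free}(\psi)$, closed $\mathrm{closed}(\psi)$); $\psi\times\psi'$ (equal free sets, disjoint closed sets; closed the union); $\psi+\psi'$ (equal free sets; closed the union); $n\in\mathbb{Z}$. Semantics for $h:\mathrm{free}\to B$: $[\mathbf{B},C(\phi,L)](h)=1$ if $\mathbf{B},h\models\phi$, else $0$; $[\mathbf{B},PV\psi](h)=\sum[\mathbf{B},\psi](h')$ over extensions $h'$ of $h$ to $\mathrm{free}(\psi)\cup V$; $[\mathbf{B},EV\psi](h)=[\mathbf{B},\psi](h|_{\mathrm{free}(\psi)})$; $\times,+$ pointwise; $[\mathbf{B},n](h)=n$. Logical equivalence: same free variables and $[\mathbf{B},\cdot]$ equal on every structure. $\mathsf{width}$ = max of $|\mathrm{free}(\theta)|$ over $\sharp$-subformulas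 (subtrees) and fo-subformulas (subformulas of $\phi$ occurring as $C(\phi,L)$). $\sharp\mathsf{PP}$ ($\sharp\mathsf{EP}$): every $C(\phi,L)$ has $\phi$ a pp- (ep-)formula. -}

module Defs where

open import Data.Bool using (Bool; true; false; if_then_else_; _∧_; _∨_; not)
open import Data.Nat using (ℕ; zero; suc; _⊔_; _≟_; _≡ᵇ_; _≤_)
open import Data.Fin using (Fin)
open import Data.Integer using (ℤ; _+_; _*_) renaming (0ℤ to 0ℤ; 1ℤ to 1ℤ)
open import Data.List using (List; []; _∷_; _++_; map; foldr; length; filter; deduplicate; allFin)
open import Data.Bool.ListAction using (any; all)
open import Data.List.Membership.Propositional using (_∈_)
open import Data.List.Membership.DecPropositional _≟_ using (_∈?_)
open import Data.Vec using (Vec)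
import Data.Vec as Vec
open import Data.Product using (_×_)
open import Data.Empty using (⊥)
open import Relation.Nullary using (¬?)
open import Relation.Binary.PropositionalEquality using (_≡_)

record Signature : Set₁ where
  field
    Sym   : Set
    arity : Sym → ℕ
open Signature public

-- A finite structure with (nonempty) universe Fin (suc size);
-- each relation symbol is interpreted as a (decidable) set of tuples.
record Structure (σ : Signature) : Set where
  field
    size : ℕ
    rel  : (r : Sym σ) → Vec (Fin (suc size)) (arity σ r) → Bool
open Structure public

Dom : {σ : Signature} → Structure σ → Set
Dom B = Fin (suc (size B))

Var : Set
Var = ℕ

Assignment : {σ : Signature} → Structure σ → Set
Assignment B = Var → Dom B

_[_↦_] : {A : Set} → (Var → A) → Var → A → (Var → A)
(h [ x ↦ a ]) y = if y ≡ᵇ x then a else h y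

-- Finite variable sets, represented by lists (read as sets)

VarSet : Set
VarSet = List Var

_⊆ᵥ_ : VarSet → VarSet → Set
A ⊆ᵥ B = ∀ {x} → x ∈ A → x ∈ B

_≈ᵥ_ : VarSet → VarSet → Set
A ≈ᵥ B = (A ⊆ᵥ B) × (B ⊆ᵥ A)

Disjoint : VarSet → VarSet → Set
Disjoint A B = ∀ {x} → x ∈ A → x ∈ B → ⊥

_∖_ : VarSet → VarSet → VarSet
A ∖ B = filter (λ x → ¬? (x ∈? B)) A

card : VarSet → ℕ
card A = length (deduplicate _≟_ A)

data FO (σ : Signature) : Set where
  atom : (r : Sym σ) → Vec Var (arity σ r) → FO σ
  neg  : FO σ → FO σ
  conj : FO σ → FO σ → FO σ
  disj : FO σ → FO σ → FO σ
  ex   : Var → FO σ → FO σ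
  fa   : Var → FO σ → FO σ

fv : {σ : Signature} → FO σ → VarSet
fv (atom r xs) = Vec.toList xs
fv (neg φ)     = fv φ
fv (conj φ ψ)  = fv φ ++ fv ψ
fv (disj φ ψ)  = fv φ ++ fv ψ
fv (ex x φ)    = fv φ ∖ (x ∷ [])
fv (fa x φ)    = fv φ ∖ (x ∷ [])

sat : {σ : Signature} (B : Structure σ) → FO σ → Assignment B → Bool
sat B (atom r xs) h = rel B r (Vec.map h xs)
sat B (neg φ)     h = not (sat B φ h)
sat B (conj φ ψ)  h = sat B φ h ∧ sat B ψ h
sat B (disj φ ψ)  h = sat B φ h ∨ sat B ψ h
sat B (ex x φ)    h = any (λ a → sat B φ (h [ x ↦ a ])) (allFin _)
sat B (fa x φ)    h = all (λ a → sat B φ (h [ x ↦ a ])) (allFin _)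

data IsPP {σ : Signature} : FO σ → Set where
  atom : ∀ r xs → IsPP (atom r xs)
  conj : ∀ {φ ψ} → IsPP φ → IsPP ψ → IsPP (conj φ ψ)
  ex   : ∀ {x φ} → IsPP φ → IsPP (ex x φ)

data IsEP {σ : Signature} : FO σ → Set where
  atom : ∀ r xs → IsEP (atom r xs)
  conj : ∀ {φ ψ} → IsEP φ → IsEP ψ → IsEP (conj φ ψ)
  disj : ∀ {φ ψ} → IsEP φ → IsEP ψ → IsEP (disj φ ψ)
  ex   : ∀ {x φ} → IsEP φ → IsEP (ex x φ)

foWidth : {σ : Signature} → FO σ → ℕ
foWidth φ@(atom r xs) = card (fv φ)
foWidth φ@(neg ψ)     = card (fv φ) ⊔ foWidth ψ
foWidth φ@(conj ψ χ)  = card (fv φ) ⊔ foWidth ψ ⊔ foWidth χ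
foWidth φ@(disj ψ χ)  = card (fv φ) ⊔ foWidth ψ ⊔ foWidth χ
foWidth φ@(ex x ψ)    = card (fv φ) ⊔ foWidth ψ
foWidth φ@(fa x ψ)    = card (fv φ) ⊔ foWidth ψ

data SF (σ : Signature) : Set where
  C    : FO σ → VarSet → SF σ
  P    : VarSet → SF σ → SF σ
  E    : VarSet → SF σ → SF σ
  _⊗_  : SF σ → SF σ → SF σ
  _⊕_  : SF σ → SF σ → SF σ
  lit  : ℤ → SF σ

free : {σ : Signature} → SF σ → VarSet
free (C φ L)  = L
free (P V ψ)  = free ψ ∖ V
free (E V ψ)  = V ++ free ψ
free (ψ ⊗ χ)  = free ψ
free (ψ ⊕ χ)  = free ψ
free (lit n)  = []

closed : {σ : Signature} → SF σ → VarSet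
closed (C φ L)  = []
closed (P V ψ)  = V ++ closed ψ
closed (E V ψ)  = closed ψ
closed (ψ ⊗ χ)  = closed ψ ++ closed χ
closed (ψ ⊕ χ)  = closed ψ ++ closed χ
closed (lit n)  = []

data WF {σ : Signature} : SF σ → Set where
  C   : ∀ {φ L} → fv φ ⊆ᵥ L → WF (C φ L)
  P   : ∀ {V ψ} → WF ψ → Disjoint V (closed ψ) → WF (P V ψ)
  E   : ∀ {V ψ} → WF ψ → Disjoint V (free ψ) → Disjoint V (closed ψ) → WF (E V ψ)
  _⊗_ : ∀ {ψ χ} → WF ψ → WF χ → free ψ ≈ᵥ free χ → Disjoint (closed ψ) (closed χ) → WF (ψ ⊗ χ)
  _⊕_ : ∀ {ψ χ} → WF ψ → WF χ → free ψ ≈ᵥ free χ → WF (ψ ⊕ χ)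
  lit : ∀ n → WF (lit n)

data AllC {σ : Signature} (Q : FO σ → Set) : SF σ → Set where
  C   : ∀ {φ L} → Q φ → AllC Q (C φ L)
  P   : ∀ {V ψ} → AllC Q ψ → AllC Q (P V ψ)
  E   : ∀ {V ψ} → AllC Q ψ → AllC Q (E V ψ)
  _⊗_ : ∀ {ψ χ} → AllC Q ψ → AllC Q χ → AllC Q (ψ ⊗ χ)
  _⊕_ : ∀ {ψ χ} → AllC Q ψ → AllC Q χ → AllC Q (ψ ⊕ χ)
  lit : ∀ n → AllC Q (lit n)

SharpPP : {σ : Signature} → SF σ → Set
SharpPP φ = WF φ × AllC IsPP φ

SharpEP : {σ : Signature} → SF σ → Set
SharpEP φ = WF φ × AllC IsEP φ

sumℤ : List ℤ → ℤ
sumℤ = foldr _+_ 0ℤ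

sumExt : {σ : Signature} (B : Structure σ) → List Var
       → (Assignment B → ℤ) → Assignment B → ℤ
sumExt B []       g h = g h
sumExt B (x ∷ xs) g h = sumℤ (map (λ a → sumExt B xs g (h [ x ↦ a ])) (allFin _))

-- [B, ψ](h); assignments are total, the value only depends on free(ψ)
⟦_,_⟧ : {σ : Signature} (B : Structure σ) → SF σ → Assignment B → ℤ
⟦ B , C φ L ⟧ h = if sat B φ h then 1ℤ else 0ℤ
⟦ B , P V ψ ⟧ h = sumExt B (deduplicate _≟_ V) ⟦ B , ψ ⟧ h
⟦ B , E V ψ ⟧ h = ⟦ B , ψ ⟧ h
⟦ B , ψ ⊗ χ ⟧ h = ⟦ B , ψ ⟧ h * ⟦ B , χ ⟧ h
⟦ B , ψ ⊕ χ ⟧ h = ⟦ B , ψ ⟧ h + ⟦ B , χ ⟧ h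
⟦ B , lit n ⟧ h = n

LogEquiv : {σ : Signature} → SF σ → SF σ → Set
LogEquiv {σ} φ ψ = (free φ ≈ᵥ free ψ)
  × (∀ (B : Structure σ) (h : Assignment B) → ⟦ B , φ ⟧ h ≡ ⟦ B , ψ ⟧ h)

width : {σ : Signature} → SF σ → ℕ
width θ@(C φ L) = card (free θ) ⊔ foWidth φ
width θ@(P V ψ) = card (free θ) ⊔ width ψ
width θ@(E V ψ) = card (free θ) ⊔ width ψ
width θ@(ψ ⊗ χ) = card (free θ) ⊔ width ψ ⊔ width χ
width θ@(ψ ⊕ χ) = card (free θ) ⊔ width ψ ⊔ width χ
width θ@(lit n) = card (free θ)

-- An ep-formula ψ is equivalent to the disjunction of the pp-formulas in its
-- disjunctive normal form (distribute ∧ over ∨ and push ∃ inside ∨); each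
-- disjunct uses only free variables of ψ and is no wider than ψ. The 0/1
-- indicator of a disjunction is counted by inclusion–exclusion,
-- [φ ∨ θ] = [φ] + [θ] − [φ]·[θ], which only needs C(φ, L), +, × and the
-- constants 0 and −1 with free variables L, so no subformula has more than
-- the width of C(ψ, L).
module Submission where

open import Defs
open import Data.Nat using (ℕ; _≤_; _⊔_; z≤n; s≤s) renaming (_≟_ to _≟ℕ_)
open import Data.Product using (Σ; _×_; _,_)
open import Data.Bool using (Bool; true; false; _∧_; _∨_; if_then_else_)
open import Data.Bool.Properties using (∨-assoc; ∨-identityʳ; ∧-zeroʳ; ∧-distribʳ-∨; ∧-distribˡ-∨; ∨-commutativeMonoid)
open import Algebra.Bundles using (CommutativeMonoid)
open import Algebra.Properties.CommutativeSemigroup (CommutativeMonoid.commutativeSemigroup ∨-commutativeMonoid) using () renaming (interchange to ∨-∨-interchange)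
open import Data.Bool.ListAction using (any; or)
open import Data.Nat.Properties using (≤-trans; ≤-refl; ≤-reflexive; ⊔-lub; ⊔-mono-≤; m≤m⊔n; m≤n⊔m)
open import Data.Integer using (ℤ; _+_; _*_; -1ℤ; 0ℤ; 1ℤ)
open import Data.List using (List; []; _∷_; _++_; map; length; filter; allFin; cartesianProductWith)
open import Data.List.Properties using (++-identityʳ; map-∘; map-cong; filter-notAll)
open import Data.List.Membership.Propositional.Properties using (∈-filter⁺; ∈-deduplicate⁺; ∈-deduplicate⁻)
import Data.List.Relation.Binary.Subset.Propositional.Properties as ⊆
open import Data.List.Relation.Unary.Any as Any using (here; there)
open import Data.List.Relation.Unary.All as All using (All; []; _∷_)
open import Data.List.Relation.Unary.All.Properties using (++⁺; map⁺; cartesianProductWith⁺)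
open import Data.List.Relation.Unary.AllPairs using (_∷_)
open import Data.List.Relation.Unary.Unique.Propositional using (Unique)
open import Data.List.Relation.Unary.Unique.DecPropositional.Properties _≟ℕ_ using (deduplicate-!)
open import Function using (id; _∘_)
open import Relation.Nullary using (¬?)
open import Relation.Binary.PropositionalEquality using (_≡_; refl; sym; trans; cong; cong₂; setoid; module ≡-Reasoning)

open ≡-Reasoning

length-mono-⊆ : ∀ {xs ys : List ℕ} → Unique xs → xs ⊆ᵥ ys → length xs ≤ length ys
length-mono-⊆ {[]}     _          _     = z≤n
length-mono-⊆ {x ∷ xs} {ys} (x∉xs ∷ u) x∷xs⊆ys =
  ≤-trans (s≤s (length-mono-⊆ u xs⊆ys-x))
          (filter-notAll (λ y → ¬? (x ≟ℕ y)) ys (Any.map (λ x≡y x≢y → x≢y x≡y) (x∷xs⊆ys (here refl))))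
  where
  xs⊆ys-x : xs ⊆ᵥ filter (λ y → ¬? (x ≟ℕ y)) ys
  xs⊆ys-x z∈xs = ∈-filter⁺ _ (x∷xs⊆ys (there z∈xs)) (λ { refl → All.lookup x∉xs z∈xs refl })

card-mono : ∀ {A B} → A ⊆ᵥ B → card A ≤ card B
card-mono {A} A⊆B = length-mono-⊆ (deduplicate-! A) (∈-deduplicate⁺ _≟ℕ_ ∘ A⊆B ∘ ∈-deduplicate⁻ _≟ℕ_ A)

card-++-[] : ∀ A → card (A ++ []) ≡ card A
card-++-[] A = cong card (++-identityʳ A)

≈ᵥ-reflexive : ∀ {A B} → A ≡ B → A ≈ᵥ B
≈ᵥ-reflexive refl = id , id

private
  variable
    A B X : Set

any-++ : ∀ (p : A → Bool) xs ys → any p (xs ++ ys) ≡ any p xs ∨ any p ys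
any-++ p []       ys = refl
any-++ p (x ∷ xs) ys = begin
  p x ∨ any p (xs ++ ys)       ≡⟨ cong (p x ∨_) (any-++ p xs ys) ⟩
  p x ∨ (any p xs ∨ any p ys)  ≡⟨ ∨-assoc (p x) _ _ ⟨
  (p x ∨ any p xs) ∨ any p ys  ∎

any-map : ∀ (p : B → Bool) (f : A → B) xs → any p (map f xs) ≡ any (p ∘ f) xs
any-map p f xs = cong or (sym (map-∘ xs))

any-cong : ∀ {p q : A → Bool} → (∀ x → p x ≡ q x) → ∀ xs → any p xs ≡ any q xs
any-cong p≗q xs = cong or (map-cong p≗q xs)

any-false : ∀ xs → any (λ (_ : A) → false) xs ≡ false
any-false []       = refl
any-false (_ ∷ xs) = any-false xs

any-∧ˡ : ∀ b (p : A → Bool) xs → any (λ x → b ∧ p x) xs ≡ b ∧ any p xs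
any-∧ˡ b p []       = sym (∧-zeroʳ b)
any-∧ˡ b p (x ∷ xs) = begin
  b ∧ p x ∨ any (λ x → b ∧ p x) xs  ≡⟨ cong (b ∧ p x ∨_) (any-∧ˡ b p xs) ⟩
  b ∧ p x ∨ b ∧ any p xs            ≡⟨ ∧-distribˡ-∨ b (p x) _ ⟨
  b ∧ (p x ∨ any p xs)              ∎

any-∧ʳ : ∀ b (p : A → Bool) xs → any (λ x → p x ∧ b) xs ≡ any p xs ∧ b
any-∧ʳ b p []       = refl
any-∧ʳ b p (x ∷ xs) = begin
  p x ∧ b ∨ any (λ x → p x ∧ b) xs  ≡⟨ cong (p x ∧ b ∨_) (any-∧ʳ b p xs) ⟩
  p x ∧ b ∨ any p xs ∧ b            ≡⟨ ∧-distribʳ-∨ b (p x) _ ⟨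
  (p x ∨ any p xs) ∧ b              ∎

any-∨ : ∀ (p q : A → Bool) xs → any (λ x → p x ∨ q x) xs ≡ any p xs ∨ any q xs
any-∨ p q []       = refl
any-∨ p q (x ∷ xs) = begin
  (p x ∨ q x) ∨ any (λ x → p x ∨ q x) xs  ≡⟨ cong ((p x ∨ q x) ∨_) (any-∨ p q xs) ⟩
  (p x ∨ q x) ∨ (any p xs ∨ any q xs)     ≡⟨ ∨-∨-interchange (p x) (q x) _ _ ⟩
  (p x ∨ any p xs) ∨ (q x ∨ any q xs)     ∎

any-comm : ∀ (f : A → B → Bool) xs ys →
           any (λ x → any (f x) ys) xs ≡ any (λ y → any (λ x → f x y) xs) ys
any-comm f []       ys = sym (any-false ys)
any-comm f (x ∷ xs) ys = begin
  any (f x) ys ∨ any (λ x → any (f x) ys) xs          ≡⟨ cong (any (f x) ys ∨_) (any-comm f xs ys) ⟩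
  any (f x) ys ∨ any (λ y → any (λ x → f x y) xs) ys  ≡⟨ any-∨ (f x) _ ys ⟨
  any (λ y → f x y ∨ any (λ x → f x y) xs) ys         ∎

any-cartesianProductWith : ∀ (p : X → Bool) (f : A → B → X) xs ys →
  any p (cartesianProductWith f xs ys) ≡ any (λ x → any (p ∘ f x) ys) xs
any-cartesianProductWith p f []       ys = refl
any-cartesianProductWith p f (x ∷ xs) ys = begin
  any p (map (f x) ys ++ cartesianProductWith f xs ys)
    ≡⟨ any-++ p (map (f x) ys) _ ⟩
  any p (map (f x) ys) ∨ any p (cartesianProductWith f xs ys)
    ≡⟨ cong₂ _∨_ (any-map p (f x) ys) (any-cartesianProductWith p f xs ys) ⟩
  any (p ∘ f x) ys ∨ any (λ x → any (p ∘ f x) ys) xs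
    ∎

module _ {σ : Signature} where

  disjuncts : FO σ → List (FO σ)
  disjuncts (conj φ ψ) = cartesianProductWith conj (disjuncts φ) (disjuncts ψ)
  disjuncts (disj φ ψ) = disjuncts φ ++ disjuncts ψ
  disjuncts (ex x φ)   = map (ex x) (disjuncts φ)
  disjuncts φ          = φ ∷ []

  disjuncts-pp : ∀ {ψ} → IsEP ψ → All IsPP (disjuncts ψ)
  disjuncts-pp (atom r xs) = atom r xs ∷ []
  disjuncts-pp (conj φ ψ)  = cartesianProductWith⁺ (setoid _) (setoid _) conj _ _
    λ φ′∈ ψ′∈ → conj (All.lookup (disjuncts-pp φ) φ′∈) (All.lookup (disjuncts-pp ψ) ψ′∈)
  disjuncts-pp (disj φ ψ)  = ++⁺ (disjuncts-pp φ) (disjuncts-pp ψ)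
  disjuncts-pp (ex φ)      = map⁺ (All.map ex (disjuncts-pp φ))

  sat-disjuncts : ∀ (B : Structure σ) ψ h → sat B ψ h ≡ any (λ φ → sat B φ h) (disjuncts ψ)
  sat-disjuncts B (conj φ ψ) h = begin
    sat B φ h ∧ sat B ψ h
      ≡⟨ cong₂ _∧_ (sat-disjuncts B φ h) (sat-disjuncts B ψ h) ⟩
    any holds (disjuncts φ) ∧ any holds (disjuncts ψ)
      ≡⟨ any-∧ʳ _ holds (disjuncts φ) ⟨
    any (λ φ′ → holds φ′ ∧ any holds (disjuncts ψ)) (disjuncts φ)
      ≡⟨ any-cong (λ φ′ → any-∧ˡ (holds φ′) holds (disjuncts ψ)) (disjuncts φ) ⟨
    any (λ φ′ → any (holds ∘ conj φ′) (disjuncts ψ)) (disjuncts φ)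
      ≡⟨ any-cartesianProductWith holds conj (disjuncts φ) (disjuncts ψ) ⟨
    any holds (disjuncts (conj φ ψ))
      ∎
    where
    holds : FO σ → Bool
    holds φ′ = sat B φ′ h
  sat-disjuncts B (disj φ ψ) h = begin
    sat B φ h ∨ sat B ψ h
      ≡⟨ cong₂ _∨_ (sat-disjuncts B φ h) (sat-disjuncts B ψ h) ⟩
    any holds (disjuncts φ) ∨ any holds (disjuncts ψ)
      ≡⟨ any-++ holds (disjuncts φ) (disjuncts ψ) ⟨
    any holds (disjuncts φ ++ disjuncts ψ)
      ∎
    where
    holds : FO σ → Bool
    holds φ′ = sat B φ′ h
  sat-disjuncts B (ex x φ) h = begin
    any (λ a → sat B φ (h [ x ↦ a ])) (allFin _)
      ≡⟨ any-cong (λ a → sat-disjuncts B φ (h [ x ↦ a ])) (allFin _) ⟩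
    any (λ a → any (λ φ′ → sat B φ′ (h [ x ↦ a ])) (disjuncts φ)) (allFin _)
      ≡⟨ any-comm (λ a φ′ → sat B φ′ (h [ x ↦ a ])) (allFin _) (disjuncts φ) ⟩
    any (λ φ′ → sat B (ex x φ′) h) (disjuncts φ)
      ≡⟨ any-map (λ φ′ → sat B φ′ h) (ex x) (disjuncts φ) ⟨
    any (λ φ′ → sat B φ′ h) (map (ex x) (disjuncts φ))
      ∎
  sat-disjuncts B (atom r xs) h = sym (∨-identityʳ _)
  sat-disjuncts B (neg φ)     h = sym (∨-identityʳ _)
  sat-disjuncts B (fa x φ)    h = sym (∨-identityʳ _)

  record _≼_ (φ ψ : FO σ) : Set where
    constructor _,_
    field
      fv-⊆    : fv φ ⊆ᵥ fv ψ
      width-≤ : foWidth φ ≤ foWidth ψ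
  open _≼_ public

  ≼-refl : ∀ {φ} → φ ≼ φ
  ≼-refl = id , ≤-refl

  conj-mono-≼ : ∀ {φ φ′ ψ ψ′} → φ′ ≼ φ → ψ′ ≼ ψ → conj φ′ ψ′ ≼ conj φ ψ
  conj-mono-≼ (fvφ , wφ) (fvψ , wψ) = fv⊆ , ⊔-mono-≤ (⊔-mono-≤ (card-mono fv⊆) wφ) wψ
    where fv⊆ = ⊆.++⁺ fvφ fvψ

  ex-mono-≼ : ∀ {x φ φ′} → φ′ ≼ φ → ex x φ′ ≼ ex x φ
  ex-mono-≼ (fvφ , wφ) = fv⊆ , ⊔-mono-≤ (card-mono fv⊆) wφ
    where fv⊆ = ⊆.filter⁺′ _ _ id fvφ

  disjˡ-≼ : ∀ {φ′ φ ψ} → φ′ ≼ φ → φ′ ≼ disj φ ψ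
  disjˡ-≼ {φ = φ} {ψ} (fvφ , wφ) =
    ⊆.xs⊆xs++ys _ _ ∘ fvφ , ≤-trans wφ (≤-trans (m≤n⊔m (card (fv φ ++ fv ψ)) _) (m≤m⊔n _ (foWidth ψ)))

  disjʳ-≼ : ∀ {ψ′ φ ψ} → ψ′ ≼ ψ → ψ′ ≼ disj φ ψ
  disjʳ-≼ {φ = φ} (fvψ , wψ) = ⊆.xs⊆ys++xs _ (fv φ) ∘ fvψ , ≤-trans wψ (m≤n⊔m _ _)

  disjuncts-≼ : ∀ ψ → All (_≼ ψ) (disjuncts ψ)
  disjuncts-≼ (conj φ ψ)  = cartesianProductWith⁺ (setoid _) (setoid _) conj _ _
    λ φ′∈ ψ′∈ → conj-mono-≼ (All.lookup (disjuncts-≼ φ) φ′∈) (All.lookup (disjuncts-≼ ψ) ψ′∈)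
  disjuncts-≼ (disj φ ψ)  = ++⁺ (All.map disjˡ-≼ (disjuncts-≼ φ)) (All.map disjʳ-≼ (disjuncts-≼ ψ))
  disjuncts-≼ (ex x φ)    = map⁺ (All.map ex-mono-≼ (disjuncts-≼ φ))
  disjuncts-≼ (atom r xs) = ≼-refl ∷ []
  disjuncts-≼ (neg φ)     = ≼-refl ∷ []
  disjuncts-≼ (fa x φ)    = ≼-refl ∷ []

𝟙 : Bool → ℤ
𝟙 b = if b then 1ℤ else 0ℤ

𝟙-∨ : ∀ b c → 𝟙 (b ∨ c) ≡ 𝟙 b + (𝟙 c + -1ℤ * (𝟙 b * 𝟙 c))
𝟙-∨ true  true  = refl
𝟙-∨ true  false = refl
𝟙-∨ false true  = refl
𝟙-∨ false false = refl

module _ {σ : Signature} where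

  indicator : VarSet → List (FO σ) → SF σ
  indicator L []       = E L (lit 0ℤ)
  indicator L (φ ∷ φs) = C φ L ⊕ (indicator L φs ⊕ (E L (lit -1ℤ) ⊗ (C φ L ⊗ indicator L φs)))

  free-indicator : ∀ L φs → free (indicator L φs) ≡ L
  free-indicator L []      = ++-identityʳ L
  free-indicator L (_ ∷ _) = refl

  indicator-WF : ∀ L φs → All (λ φ → fv φ ⊆ᵥ L) φs → WF (indicator L φs)
  indicator-WF L []       []             = E (lit 0ℤ) (λ _ ()) (λ _ ())
  indicator-WF L (φ ∷ φs) (fv⊆L ∷ fvs⊆L) =
    _⊕_ (C fv⊆L) (_⊕_ wfφs (_⊗_ constant (_⊗_ (C fv⊆L) wfφs L≈φs (λ ())) L++[]≈L (λ ())) φs≈L++[]) L≈φs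
    where
    wfφs     = indicator-WF L φs fvs⊆L
    constant = E (lit -1ℤ) (λ _ ()) (λ _ ())
    L≈φs     = ≈ᵥ-reflexive (sym (free-indicator L φs))
    L++[]≈L  = ≈ᵥ-reflexive (++-identityʳ L)
    φs≈L++[] = ≈ᵥ-reflexive (trans (free-indicator L φs) (sym (++-identityʳ L)))

  indicator-AllC : ∀ {Q} L φs → All Q φs → AllC Q (indicator L φs)
  indicator-AllC L []       []         = E (lit 0ℤ)
  indicator-AllC L (φ ∷ φs) (qφ ∷ qφs) =
    C qφ ⊕ (indicator-AllC L φs qφs ⊕ (E (lit -1ℤ) ⊗ (C qφ ⊗ indicator-AllC L φs qφs)))

  ⟦indicator⟧ : ∀ L φs (B : Structure σ) h → ⟦ B , indicator L φs ⟧ h ≡ 𝟙 (any (λ φ → sat B φ h) φs)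
  ⟦indicator⟧ L []       B h = refl
  ⟦indicator⟧ L (φ ∷ φs) B h = begin
    𝟙 (sat B φ h) + (⟦ B , indicator L φs ⟧ h + -1ℤ * (𝟙 (sat B φ h) * ⟦ B , indicator L φs ⟧ h))
      ≡⟨ cong (λ r → 𝟙 (sat B φ h) + (r + -1ℤ * (𝟙 (sat B φ h) * r))) (⟦indicator⟧ L φs B h) ⟩
    𝟙 (sat B φ h) + (𝟙 any-φs + -1ℤ * (𝟙 (sat B φ h) * 𝟙 any-φs))
      ≡⟨ 𝟙-∨ (sat B φ h) any-φs ⟨
    𝟙 (sat B φ h ∨ any-φs) ∎
    where any-φs = any (λ φ → sat B φ h) φs

  width-constant : ∀ {m} L n → card L ≤ m → width (E {σ = σ} L (lit n)) ≤ m
  width-constant L n |L|≤m = ⊔-lub (≤-trans (≤-reflexive (card-++-[] L)) |L|≤m) z≤n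

  width-indicator : ∀ {m} L φs → card L ≤ m → All (λ φ → foWidth φ ≤ m) φs → width (indicator L φs) ≤ m
  width-indicator L []       |L|≤m []         = width-constant L 0ℤ |L|≤m
  width-indicator L (φ ∷ φs) |L|≤m (wφ ∷ wφs) =
    ⊔-lub (⊔-lub |L|≤m wCφ)
      (⊔-lub (⊔-lub |free|≤m wφs′)
        (⊔-lub (⊔-lub |L++[]|≤m w-1) (⊔-lub (⊔-lub |L|≤m wCφ) wφs′)))
    where
    wCφ       = ⊔-lub |L|≤m wφ
    wφs′      = width-indicator L φs |L|≤m wφs
    w-1       = width-constant L -1ℤ |L|≤m
    |free|≤m  = ≤-trans (≤-reflexive (cong card (free-indicator L φs))) |L|≤m
    |L++[]|≤m = ≤-trans (≤-reflexive (card-++-[] L)) |L|≤m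

lemmaC2 : (σ : Signature) →
    Σ (FO σ → VarSet → SF σ) λ alg →
      ∀ (ψ : FO σ) (L : VarSet) → SharpEP (C ψ L) →
        SharpPP (alg ψ L) × LogEquiv (C ψ L) (alg ψ L) × width (alg ψ L) ≤ width (C ψ L)
lemmaC2 σ = (λ ψ L → indicator L (disjuncts ψ)) , correct
  where
  correct : ∀ (ψ : FO σ) (L : VarSet) → SharpEP (C ψ L) →
    SharpPP (indicator L (disjuncts ψ)) × LogEquiv (C ψ L) (indicator L (disjuncts ψ))
      × width (indicator L (disjuncts ψ)) ≤ width (C ψ L)
  correct ψ L (C fvψ⊆L , C epψ) =
    ( indicator-WF L (disjuncts ψ) (All.map (λ φ≼ψ {_} → fvψ⊆L ∘ fv-⊆ φ≼ψ) (disjuncts-≼ ψ))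
    , indicator-AllC L (disjuncts ψ) (disjuncts-pp epψ) )
    , ( ≈ᵥ-reflexive (sym (free-indicator L (disjuncts ψ)))
      , λ B h → trans (cong 𝟙 (sat-disjuncts B ψ h)) (sym (⟦indicator⟧ L (disjuncts ψ) B h)) )
    , width-indicator L (disjuncts ψ) (m≤m⊔n (card L) (foWidth ψ))
        (All.map (λ φ≼ψ → ≤-trans (width-≤ φ≼ψ) (m≤n⊔m (card L) (foWidth ψ))) (disjuncts-≼ ψ))
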